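{- For natural numbers (nonnegative integers) $n,m$ with $n\geq m$, $$B_{2n}=2(B_{n-m}C_{n+m}+B_mC_m).$$
   Context: The balancing numbers $B_k$ ($k\ge 0$) are defined by $B_0=0$, $B_1=1$, $B_{k+1}=6B_k-B_{k-1}$ for $k\ge1$. The Lucas-balancing numbers $C_k$ ($k\ge0$) are defined by $C_0=1$, $C_1=3$, $C_{k+1}=6C_k-C_{k-1}$ for $k\ge1$. -}

module Defs where

open import Data.Nat using (ℕ; zero; suc)
open import Data.Integer using (ℤ; +_; _-_; _*_)

B : ℕ → ℤ
B zero = + 0
B (suc zero) = + 1
B (suc (suc k)) = + 6 * B (suc k) - B k

C : ℕ → ℤ
C zero = + 1
C (suc zero) = + 3
C (suc (suc k)) = + 6 * C (suc k) - C k

module Submission where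

-- Both sequences satisfy the first-order system
--   B (k+1) = 3 B k + C k,   C (k+1) = 8 B k + 3 C k,
-- from which the addition formulas
--   B (a+b) = B a C b + C a B b,   C (a+b) = C a C b + 8 B a B b
-- follow by induction on a, and the Pell identity C a ² - 8 B a ² = 1 by
-- induction (the quadratic form is invariant under the step map).
-- Combining these gives the subtraction formula B d = C a B (a+d) - B a C (a+d),
-- hence the product-to-sum identity
--   B (2a + d) = 2 B a C (a+d) + B d,
-- and the doubling formula B (2a) = 2 B a C a.  With k = n - m and d = 2m,
-- the product-to-sum identity turns B (2n) into 2 B k C (n+m) + B (2m), and the
-- doubling formula rewrites B (2m) as 2 B m C m, which is the theorem.

open import Defs
open import Data.Nat using (ℕ; _≥_; _∸_; zero; suc) renaming (_+_ to _+ℕ_; _*_ to _*ℕ_)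
open import Data.Integer using (+_; _+_; _*_; _-_)
open import Data.Integer.Properties using (*-identityˡ; *-distribˡ-+)
open import Data.Integer.Tactic.RingSolver using (solve-∀)
import Data.Nat.Tactic.RingSolver as ℕ-Solver
open import Data.Nat.Properties using (m∸n+n≡m; +-assoc)
open import Data.Product using (_×_; _,_; proj₁; proj₂)
open import Relation.Binary.PropositionalEquality using (_≡_; refl; sym; trans; cong; cong₂)
open Relation.Binary.PropositionalEquality.≡-Reasoning

-- The second-order recurrences factor through a first-order linear system;
-- both components are proved together since each step uses both.
firstOrder : ∀ k → B (suc k) ≡ + 3 * B k + C k
                 × C (suc k) ≡ + 8 * B k + + 3 * C k
firstOrder zero = refl , refl
firstOrder (suc k) with firstOrder k
... | stepB , stepC = nextB , nextC
  where
  nextB : + 6 * B (suc k) - B k ≡ + 3 * B (suc k) + C (suc k)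
  nextB = begin
    + 6 * B (suc k) - B k                          ≡⟨ cong (λ t → + 6 * t - B k) stepB ⟩
    + 6 * (+ 3 * B k + C k) - B k                  ≡⟨ identity (B k) (C k) ⟩
    + 3 * (+ 3 * B k + C k) + (+ 8 * B k + + 3 * C k) ≡⟨ cong₂ (λ s t → + 3 * s + t) (sym stepB) (sym stepC) ⟩
    + 3 * B (suc k) + C (suc k)                    ∎
    where
    identity : ∀ y z → + 6 * (+ 3 * y + z) - y ≡ + 3 * (+ 3 * y + z) + (+ 8 * y + + 3 * z)
    identity = solve-∀

  nextC : + 6 * C (suc k) - C k ≡ + 8 * B (suc k) + + 3 * C (suc k)
  nextC = begin
    + 6 * C (suc k) - C k                                  ≡⟨ cong (λ t → + 6 * t - C k) stepC ⟩
    + 6 * (+ 8 * B k + + 3 * C k) - C k                    ≡⟨ identity (B k) (C k) ⟩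
    + 8 * (+ 3 * B k + C k) + + 3 * (+ 8 * B k + + 3 * C k) ≡⟨ cong₂ (λ s t → + 8 * s + + 3 * t) (sym stepB) (sym stepC) ⟩
    + 8 * B (suc k) + + 3 * C (suc k)                      ∎
    where
    identity : ∀ y z → + 6 * (+ 8 * y + + 3 * z) - z ≡ + 8 * (+ 3 * y + z) + + 3 * (+ 8 * y + + 3 * z)
    identity = solve-∀

addition : ∀ a b → B (a +ℕ b) ≡ B a * C b + C a * B b
                 × C (a +ℕ b) ≡ C a * C b + + 8 * (B a * B b)
addition zero b = baseB (B b) (C b) , baseC (B b) (C b)
  where
  baseB : ∀ y z → y ≡ + 0 * z + + 1 * y
  baseB = solve-∀
  baseC : ∀ y z → z ≡ + 1 * z + + 8 * (+ 0 * y)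
  baseC = solve-∀
addition (suc a) b with firstOrder a | firstOrder (a +ℕ b) | addition a b
... | stepB , stepC | stepB' , stepC' | addB , addC = sumB , sumC
  where
  sumB : B (suc (a +ℕ b)) ≡ B (suc a) * C b + C (suc a) * B b
  sumB = begin
    B (suc (a +ℕ b))                       ≡⟨ stepB' ⟩
    + 3 * B (a +ℕ b) + C (a +ℕ b)           ≡⟨ cong₂ (λ s t → + 3 * s + t) addB addC ⟩
    + 3 * (B a * C b + C a * B b) + (C a * C b + + 8 * (B a * B b))
                                           ≡⟨ identity (B a) (C a) (B b) (C b) ⟩
    (+ 3 * B a + C a) * C b + (+ 8 * B a + + 3 * C a) * B b
                                           ≡⟨ cong₂ (λ s t → s * C b + t * B b) (sym stepB) (sym stepC) ⟩
    B (suc a) * C b + C (suc a) * B b       ∎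
    where
    identity : ∀ x y u v → + 3 * (x * v + y * u) + (y * v + + 8 * (x * u))
                           ≡ (+ 3 * x + y) * v + (+ 8 * x + + 3 * y) * u
    identity = solve-∀

  sumC : C (suc (a +ℕ b)) ≡ C (suc a) * C b + + 8 * (B (suc a) * B b)
  sumC = begin
    C (suc (a +ℕ b))                       ≡⟨ stepC' ⟩
    + 8 * B (a +ℕ b) + + 3 * C (a +ℕ b)     ≡⟨ cong₂ (λ s t → + 8 * s + + 3 * t) addB addC ⟩
    + 8 * (B a * C b + C a * B b) + + 3 * (C a * C b + + 8 * (B a * B b))
                                           ≡⟨ identity (B a) (C a) (B b) (C b) ⟩
    (+ 8 * B a + + 3 * C a) * C b + + 8 * ((+ 3 * B a + C a) * B b)
                                           ≡⟨ cong₂ (λ s t → s * C b + + 8 * (t * B b)) (sym stepC) (sym stepB) ⟩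
    C (suc a) * C b + + 8 * (B (suc a) * B b) ∎
    where
    identity : ∀ x y u v → + 8 * (x * v + y * u) + + 3 * (y * v + + 8 * (x * u))
                           ≡ (+ 8 * x + + 3 * y) * v + + 8 * ((+ 3 * x + y) * u)
    identity = solve-∀

-- Pell identity: the form z² - 8y² is invariant under the first-order step
-- (y , z) ↦ (3y + z , 8y + 3z) and equals 1 at k = 0.
pell : ∀ a → C a * C a - + 8 * (B a * B a) ≡ + 1
pell zero = refl
pell (suc a) with firstOrder a
... | stepB , stepC = begin
  C (suc a) * C (suc a) - + 8 * (B (suc a) * B (suc a))
      ≡⟨ cong₂ (λ s t → t * t - + 8 * (s * s)) stepB stepC ⟩
  (+ 8 * B a + + 3 * C a) * (+ 8 * B a + + 3 * C a) - + 8 * ((+ 3 * B a + C a) * (+ 3 * B a + C a))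
      ≡⟨ invariance (B a) (C a) ⟩
  C a * C a - + 8 * (B a * B a)
      ≡⟨ pell a ⟩
  + 1 ∎
  where
  invariance : ∀ y z → (+ 8 * y + + 3 * z) * (+ 8 * y + + 3 * z) - + 8 * ((+ 3 * y + z) * (+ 3 * y + z))
                       ≡ z * z - + 8 * (y * y)
  invariance = solve-∀

-- Subtraction formula B ((a + d) - a) = C a B (a + d) - B a C (a + d); the Pell
-- identity is exactly what makes the cross terms collapse to B d.
subtraction : ∀ a d → C a * B (a +ℕ d) - B a * C (a +ℕ d) ≡ B d
subtraction a d = begin
  C a * B (a +ℕ d) - B a * C (a +ℕ d)
      ≡⟨ cong₂ (λ s t → C a * s - B a * t) (proj₁ (addition a d)) (proj₂ (addition a d)) ⟩
  C a * (B a * C d + C a * B d) - B a * (C a * C d + + 8 * (B a * B d))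
      ≡⟨ identity (B a) (C a) (B d) (C d) ⟩
  (C a * C a - + 8 * (B a * B a)) * B d
      ≡⟨ cong (_* B d) (pell a) ⟩
  + 1 * B d
      ≡⟨ *-identityˡ (B d) ⟩
  B d ∎
  where
  identity : ∀ x y u v → y * (x * v + y * u) - x * (y * v + + 8 * (x * u)) ≡ (y * y - + 8 * (x * x)) * u
  identity = solve-∀

productToSum : ∀ a d → B (a +ℕ (a +ℕ d)) ≡ + 2 * (B a * C (a +ℕ d)) + B d
productToSum a d = begin
  B (a +ℕ (a +ℕ d))
      ≡⟨ proj₁ (addition a (a +ℕ d)) ⟩
  B a * C (a +ℕ d) + C a * B (a +ℕ d)
      ≡⟨ regroup (B a * C (a +ℕ d)) (C a * B (a +ℕ d)) ⟩
  + 2 * (B a * C (a +ℕ d)) + (C a * B (a +ℕ d) - B a * C (a +ℕ d))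
      ≡⟨ cong (_+_ (+ 2 * (B a * C (a +ℕ d)))) (subtraction a d) ⟩
  + 2 * (B a * C (a +ℕ d)) + B d ∎
  where
  regroup : ∀ p q → p + q ≡ + 2 * p + (q - p)
  regroup = solve-∀

doubling : ∀ a → B (a +ℕ a) ≡ + 2 * (B a * C a)
doubling a = trans (proj₁ (addition a a)) (symmetrise (B a) (C a))
  where
  symmetrise : ∀ x y → x * y + y * x ≡ + 2 * (x * y)
  symmetrise = solve-∀

mainTheorem11 : (n m : ℕ) → n ≥ m →
    B (2 *ℕ n) ≡ + 2 * (B (n ∸ m) * C (n +ℕ m) + B m * C m)
mainTheorem11 n m n≥m = begin
  B (2 *ℕ n)                                       ≡⟨ cong B twiceN ⟩
  B (k +ℕ (k +ℕ (m +ℕ m)))                          ≡⟨ productToSum k (m +ℕ m) ⟩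
  + 2 * (B k * C (k +ℕ (m +ℕ m))) + B (m +ℕ m)      ≡⟨ cong₂ (λ i t → + 2 * (B k * C i) + t) (sym nPlusM) (doubling m) ⟩
  + 2 * (B k * C (n +ℕ m)) + + 2 * (B m * C m)      ≡⟨ sym (*-distribˡ-+ (+ 2) (B k * C (n +ℕ m)) (B m * C m)) ⟩
  + 2 * (B k * C (n +ℕ m) + B m * C m)              ∎
  where
  k : ℕ
  k = n ∸ m
  n≡k+m : n ≡ k +ℕ m
  n≡k+m = sym (m∸n+n≡m n≥m)
  nPlusM : n +ℕ m ≡ k +ℕ (m +ℕ m)
  nPlusM = trans (cong (_+ℕ m) n≡k+m) (+-assoc k m m)
  twiceN : 2 *ℕ n ≡ k +ℕ (k +ℕ (m +ℕ m))
  twiceN = trans (cong (2 *ℕ_) n≡k+m) (twiceSum k m)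
    where
    twiceSum : ∀ i j → 2 *ℕ (i +ℕ j) ≡ i +ℕ (i +ℕ (j +ℕ j))
    twiceSum = ℕ-Solver.solve-∀
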